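{- For all nonnegative integers $k,n$, $a_{k,n}$ equals the number of pairs $(c_1,c_2)$, where $c_1$ is an ordered composition of $k$ and $c_2$ is an ordered composition of $n$, each with all summands in $\{1,2\}$, such that $c_1$ and $c_2$ contain the same number of summands equal to $1$.
   Context: For nonnegative integers $k,n$, let $a_{k,n}$ be the number of ways to partition a set consisting of $k$ marked points on a line and $n$ marked points on a parallel line into pairs, joining the two points of each pair by a straight segment, such that no two segments have a common point (in particular, no endpoint lies on another segment). We have $a_{0,0}=1$. A composition of $m$ is a representation of $m$ as an ordered sum of positive integers. Sums differing in the order of the summands are considered different. The number $0$ has exactly one composition, the empty one. -}

module Defs where

open import Data.Bool using (Bool; true; false; _∧_; _∨_; not; if_then_else_)
open import Data.Nat using (ℕ; zero; suc; _+_; _≤ᵇ_; _<ᵇ_; _≡ᵇ_; _⊓_; _⊔_)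
open import Data.Fin using (Fin; toℕ)
open import Data.List using (List; []; _∷_; map; concatMap; filterᵇ; length; upTo; allFin; cartesianProduct)
open import Data.Nat.ListAction using (sum)
open import Data.Bool.ListAction using (all)
open import Data.Vec using (Vec; lookup)
open import Data.Product using (_×_; _,_)

-- The k + n points are numbered 0 .. k+n-1.  Point p with p < k is the
-- p-th point (from the left) on the first line; point p with p ≥ k is
-- the (p ∸ k)-th point (from the left) on the second, parallel line
-- (both lines oriented the same way).  Along each line the raw index
-- order coincides with the geometric order, so raw indices are compared.

onFirst : ℕ → ℕ → Bool
onFirst k p = p <ᵇ k

between : ℕ → ℕ → ℕ → Bool
between a b e = ((a ⊓ b) ≤ᵇ e) ∧ (e ≤ᵇ (a ⊔ b))

sameLine : ℕ → ℕ → ℕ → Bool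
sameLine k a b = onFirst k a ≡bool onFirst k b
  where
  _≡bool_ : Bool → Bool → Bool
  true ≡bool y = y
  false ≡bool y = not y

endOnLineOf : ℕ → ℕ → ℕ → ℕ → ℕ
endOnLineOf k a c d = if sameLine k a c then c else d

firstEnd secondEnd : ℕ → ℕ → ℕ → ℕ
firstEnd k a b = if onFirst k a then a else b
secondEnd k a b = if onFirst k a then b else a

-- Do the closed straight segments [a,b] and [c,d] have a common point?
meets : ℕ → (ℕ × ℕ) → (ℕ × ℕ) → Bool
meets k (a , b) (c , d) with sameLine k a b | sameLine k c d
... | true  | true  = sameLine k a c
                        ∧ ((a ⊓ b) ≤ᵇ (c ⊔ d)) ∧ ((c ⊓ d) ≤ᵇ (a ⊔ b))
... | true  | false = between a b (endOnLineOf k a c d)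
... | false | true  = between c d (endOnLineOf k c a b)
... | false | false =
  let x = firstEnd k a b ; y = secondEnd k a b
      x' = firstEnd k c d ; y' = secondEnd k c d
  in ((x ≤ᵇ x') ∧ (y' ≤ᵇ y)) ∨ ((x' ≤ᵇ x) ∧ (y ≤ᵇ y'))

-- Partitions into pairs, encoded by the partner map v (v[p] = partner of p).

allVecs : (m : ℕ) → (l : ℕ) → List (Vec (Fin m) l)
allVecs m zero = Data.Vec.[] ∷ []
allVecs m (suc l) = concatMap (λ x → map (x Data.Vec.∷_) (allVecs m l)) (allFin m)

partner : ∀ {m} → Vec (Fin m) m → Fin m → ℕ
partner v p = toℕ (lookup v p)

isPairing : ∀ {m} → Vec (Fin m) m → Bool
isPairing {m} v = all (λ p → not (partner v p ≡ᵇ toℕ p)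
                            ∧ (toℕ (lookup v (lookup v p)) ≡ᵇ toℕ p)) (allFin m)

noCommonPoint : (k : ℕ) → ∀ {m} → Vec (Fin m) m → Bool
noCommonPoint k {m} v =
  all (λ p → all (λ q →
         (toℕ p ≡ᵇ toℕ q) ∨ (toℕ q ≡ᵇ partner v p)
         ∨ not (meets k (toℕ p , partner v p) (toℕ q , partner v q)))
       (allFin m)) (allFin m)

validMatching : (k n : ℕ) → Vec (Fin (k + n)) (k + n) → Bool
validMatching k n v = isPairing v ∧ noCommonPoint k v

a : ℕ → ℕ → ℕ
a k n = length (filterᵇ (validMatching k n) (allVecs (k + n) (k + n)))

listsOf : ℕ → List ℕ → List (List ℕ)
listsOf zero xs = [] ∷ []
listsOf (suc l) xs = concatMap (λ x → map (x ∷_) (listsOf l xs)) xs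

compositions : ℕ → List (List ℕ)
compositions m =
  filterᵇ (λ c → sum c ≡ᵇ m)
          (concatMap (λ l → listsOf l (map suc (upTo m))) (upTo (suc m)))

partsIn12 : List ℕ → Bool
partsIn12 = all (λ x → (x ≡ᵇ 1) ∨ (x ≡ᵇ 2))

numOnes : List ℕ → ℕ
numOnes c = length (filterᵇ (λ x → x ≡ᵇ 1) c)

goodPair : List ℕ × List ℕ → Bool
goodPair (c₁ , c₂) = partsIn12 c₁ ∧ partsIn12 c₂ ∧ (numOnes c₁ ≡ᵇ numOnes c₂)

compositionPairCount : ℕ → ℕ → ℕ
compositionPairCount k n =
  length (filterᵇ goodPair (cartesianProduct (compositions k) (compositions n)))

{-# OPTIONS --safe #-}
module Submission where

-- Sweep both lines from left to right.  In a non-crossing matching the leftmost free point of a line is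
-- joined either to its right neighbour (a segment reaching further along the line would contain that
-- neighbour) or across; and if neither leftmost point is joined to its neighbour, the two are joined to
-- each other, since two segments across with farther partners would cross.  Writing 2 for a segment
-- between neighbours and a 1 on both lines for a segment across turns the matching into a pair of
-- {1,2}-compositions with equally many 1s.  Conversely, the segments read off such a pair lie, each in
-- turn, to the left of all later ones on both lines, so they never meet.  Both enumerated lists are
-- duplicate-free, so this bijection gives equal lengths.

open import Defs
open import Data.Bool using (Bool; true; false; T; not; _∧_; _∨_)
open import Data.Bool.ListAction using (all)
open import Data.Bool.Properties using (∧-zeroʳ; ∧-comm; ∨-comm; ¬-not; T-∧; T-∨; T-not-≡)
open import Data.Empty using (⊥; ⊥-elim)
open import Data.Fin using (Fin; toℕ; fromℕ<)
open import Data.Fin.Properties using (toℕ-injective; toℕ<n; fromℕ<-toℕ; toℕ-fromℕ<)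
open import Data.List
  using (List; []; _∷_; _++_; length; map; concat; concatMap; cartesianProductWith; cartesianProduct;
         upTo; allFin; filterᵇ)
import Data.List.Properties as List
open import Data.List.Properties using (length-map)
open import Data.List.Membership.Propositional using (_∈_)
open import Data.List.Membership.Propositional.Properties
  using (∈-map⁺; ∈-map⁻; ∈-cartesianProductWith⁺; ∈-cartesianProductWith⁻; ∈-cartesianProduct⁺;
         ∈-cartesianProduct⁻; ∈-allFin; ∈-upTo⁺; ∈-concat⁺′; ∈-filter⁺; ∈-filter⁻)
open import Data.List.Membership.Propositional.Properties.WithK using (unique∧set⇒bag)
open import Data.List.Relation.Binary.BagAndSetEquality using (∼bag⇒↭)
open import Data.List.Relation.Binary.Disjoint.Propositional using (Disjoint)
open import Data.List.Relation.Binary.Permutation.Propositional.Properties using (↭-length)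
open import Data.List.Relation.Unary.All as All using (All; []; _∷_)
import Data.List.Relation.Unary.All.Properties as All
import Data.List.Relation.Unary.AllPairs as AllPairs
import Data.List.Relation.Unary.AllPairs.Properties as AllPairs
open import Data.List.Relation.Unary.Any using (here; there)
open import Data.List.Relation.Unary.Unique.Propositional using (Unique)
import Data.List.Relation.Unary.Unique.Propositional.Properties as Unique
open import Data.Nat using (ℕ; zero; suc; _+_; _≤_; _<_; z≤n; s≤s; _≤ᵇ_; _≡ᵇ_; _⊓_; _⊔_; _≤?_; _<?_)
open import Data.Nat.ListAction using (sum)
open import Data.Nat.Properties
open import Data.Product using (_×_; _,_; proj₁; proj₂; ∃; swap)
open import Data.Product.Properties using (×-≡,≡→≡)
open import Data.Sum using (_⊎_; inj₁; inj₂)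
open import Data.Vec as Vec using (Vec; lookup; tabulate)
import Data.Vec.Properties as Vec
open import Data.Vec.Properties using (lookup∘tabulate; tabulate∘lookup; tabulate-cong)
open import Function using (id; _∘_; case_of_; Equivalence; mk⇔)
open import Level using (0ℓ)
open import Relation.Nullary using (¬_; yes; no; contradiction)
open import Relation.Nullary.Decidable using (T?; dec-true; dec-false; _×-dec_)
open import Relation.Unary using (Pred; _⊆_; _≐_; ｛_｝; _∪_)
open import Relation.Binary.PropositionalEquality

-- Counting by a bijection

module _ {A B : Set} (f : A → B) where

  Unique-map⁺ : ∀ {xs} → (∀ {x y} → x ∈ xs → y ∈ xs → f x ≡ f y → x ≡ y) →
                Unique xs → Unique (map f xs)
  Unique-map⁺ {[]}     inj AllPairs.[]            = AllPairs.[]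
  Unique-map⁺ {x ∷ xs} inj (x∉xs AllPairs.∷ uxs) =
    All.map⁺ (All.tabulate λ y∈ fx≡fy → All.lookup x∉xs y∈ (inj (here refl) (there y∈) fx≡fy))
    AllPairs.∷ Unique-map⁺ (λ x∈ y∈ → inj (there x∈) (there y∈)) uxs

  length-≡-by-bijection : ∀ {xs ys} → Unique xs → Unique ys →
                          (∀ {x} → x ∈ xs → f x ∈ ys) →
                          (∀ {x y} → x ∈ xs → y ∈ xs → f x ≡ f y → x ≡ y) →
                          (∀ {y} → y ∈ ys → ∃ λ x → x ∈ xs × f x ≡ y) →
                          length xs ≡ length ys
  length-≡-by-bijection {xs} {ys} uxs uys into inj onto = begin
    length xs         ≡⟨ length-map f xs ⟨
    length (map f xs) ≡⟨ ↭-length (∼bag⇒↭ (unique∧set⇒bag (Unique-map⁺ inj uxs) uys (mk⇔ to from))) ⟩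
    length ys         ∎
    where
    open ≡-Reasoning
    to : ∀ {y} → y ∈ map f xs → y ∈ ys
    to y∈ with x , x∈ , refl ← ∈-map⁻ f y∈ = into x∈
    from : ∀ {y} → y ∈ ys → y ∈ map f xs
    from y∈ with x , x∈ , refl ← onto y∈ = ∈-map⁺ f x∈

-- Compositions and enumerations

data Parts12 : List ℕ → Set where
  []  : Parts12 []
  one : ∀ {c} → Parts12 c → Parts12 (1 ∷ c)
  two : ∀ {c} → Parts12 c → Parts12 (2 ∷ c)

partsIn12⇒Parts12 : ∀ c → T (partsIn12 c) → Parts12 c
partsIn12⇒Parts12 []                       _ = []
partsIn12⇒Parts12 (1 ∷ c)                  t = one (partsIn12⇒Parts12 c t)
partsIn12⇒Parts12 (2 ∷ c)                  t = two (partsIn12⇒Parts12 c t)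
partsIn12⇒Parts12 (0 ∷ c)                  ()
partsIn12⇒Parts12 (suc (suc (suc _)) ∷ c) ()

Parts12⇒partsIn12 : ∀ {c} → Parts12 c → T (partsIn12 c)
Parts12⇒partsIn12 []      = _
Parts12⇒partsIn12 (one p) = Parts12⇒partsIn12 p
Parts12⇒partsIn12 (two p) = Parts12⇒partsIn12 p

concatMap-map≡cartesianProductWith : ∀ {A B C : Set} (f : A → B → C) xs ys →
                                     concatMap (λ x → map (f x) ys) xs ≡ cartesianProductWith f xs ys
concatMap-map≡cartesianProductWith f []       ys = refl
concatMap-map≡cartesianProductWith f (x ∷ xs) ys =
  cong (map (f x) ys ++_) (concatMap-map≡cartesianProductWith f xs ys)

allVecs-suc : ∀ m l → allVecs m (suc l) ≡ cartesianProductWith Vec._∷_ (allFin m) (allVecs m l)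
allVecs-suc m l = concatMap-map≡cartesianProductWith Vec._∷_ (allFin m) (allVecs m l)

∈-allVecs : ∀ {m l} (v : Vec (Fin m) l) → v ∈ allVecs m l
∈-allVecs Vec.[] = here refl
∈-allVecs {m} {suc l} (x Vec.∷ v) rewrite allVecs-suc m l =
  ∈-cartesianProductWith⁺ Vec._∷_ (∈-allFin x) (∈-allVecs v)

allVecs-unique : ∀ m l → Unique (allVecs m l)
allVecs-unique m zero    = [] AllPairs.∷ AllPairs.[]
allVecs-unique m (suc l) rewrite allVecs-suc m l =
  Unique.cartesianProductWith⁺ Vec._∷_ Vec.∷-injective (Unique.allFin⁺ m) (allVecs-unique m l)

listsOf-suc : ∀ l xs → listsOf (suc l) xs ≡ cartesianProductWith _∷_ xs (listsOf l xs)
listsOf-suc l xs = concatMap-map≡cartesianProductWith _∷_ xs (listsOf l xs)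

listsOf-unique : ∀ l {xs} → Unique xs → Unique (listsOf l xs)
listsOf-unique zero         _   = [] AllPairs.∷ AllPairs.[]
listsOf-unique (suc l) {xs} uxs rewrite listsOf-suc l xs =
  Unique.cartesianProductWith⁺ _∷_ List.∷-injective uxs (listsOf-unique l uxs)

length-listsOf : ∀ l xs {c} → c ∈ listsOf l xs → length c ≡ l
length-listsOf zero    xs (here refl) = refl
length-listsOf (suc l) xs c∈ rewrite listsOf-suc l xs
  with _ , _ , _ , c′∈ , refl ← ∈-cartesianProductWith⁻ _∷_ xs (listsOf l xs) c∈ =
    cong suc (length-listsOf l xs c′∈)

∈-listsOf : ∀ {xs c} → All (_∈ xs) c → c ∈ listsOf (length c) xs
∈-listsOf []                          = here refl
∈-listsOf {xs} {x ∷ c} (x∈ ∷ c∈) rewrite listsOf-suc (length c) xs =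
  ∈-cartesianProductWith⁺ _∷_ x∈ (∈-listsOf c∈)

compositions-unique : ∀ m → Unique (compositions m)
compositions-unique m =
  Unique.filter⁺ (T? ∘ λ c → sum c ≡ᵇ m) {xs = concat blocks} (Unique.concat⁺ blocks-unique blocks-disjoint)
  where
  parts  = map suc (upTo m)
  blocks = map (λ l → listsOf l parts) (upTo (suc m))
  blocks-unique : All Unique blocks
  blocks-unique = All.map⁺ (All.universal (λ l → listsOf-unique l (Unique.map⁺ suc-injective (Unique.upTo⁺ m)))
                                          (upTo (suc m)))
  disjoint : ∀ {l l′} → l ≢ l′ → Disjoint (listsOf l parts) (listsOf l′ parts)
  disjoint {l} {l′} l≢l′ (c∈ , c∈′) =
    l≢l′ (trans (sym (length-listsOf l parts c∈)) (length-listsOf l′ parts c∈′))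
  blocks-disjoint : AllPairs.AllPairs Disjoint blocks
  blocks-disjoint = AllPairs.map⁺ (AllPairs.map disjoint (Unique.upTo⁺ (suc m)))

sum-composition : ∀ {m c} → c ∈ compositions m → sum c ≡ m
sum-composition {m} {c} c∈ =
  ≡ᵇ⇒≡ (sum c) m (proj₂ (∈-filter⁻ (T? ∘ λ c → sum c ≡ᵇ m) {xs = candidates} c∈))
  where candidates = concatMap (λ l → listsOf l (map suc (upTo m))) (upTo (suc m))

Parts12-length≤sum : ∀ {c} → Parts12 c → length c ≤ sum c
Parts12-length≤sum []          = z≤n
Parts12-length≤sum (one p)     = s≤s (Parts12-length≤sum p)
Parts12-length≤sum (two {c} p) = s≤s (≤-trans (Parts12-length≤sum p) (m≤n+m (sum c) 1))

Parts12-bounded : ∀ {c m} → Parts12 c → sum c ≤ m → All (_∈ map suc (upTo m)) c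
Parts12-bounded []          _  = []
Parts12-bounded (one {c} p) le =
  ∈-map⁺ suc (∈-upTo⁺ (≤-trans (s≤s z≤n) le)) ∷ Parts12-bounded p (≤-trans (m≤n+m (sum c) 1) le)
Parts12-bounded (two {c} p) le =
  ∈-map⁺ suc (∈-upTo⁺ (≤-trans (s≤s (s≤s z≤n)) le)) ∷ Parts12-bounded p (≤-trans (m≤n+m (sum c) 2) le)

Parts12-∈-compositions : ∀ {c} → Parts12 c → c ∈ compositions (sum c)
Parts12-∈-compositions {c} p =
  ∈-filter⁺ (T? ∘ λ c′ → sum c′ ≡ᵇ sum c)
            (∈-concat⁺′ (∈-listsOf (Parts12-bounded p ≤-refl))
                        (∈-map⁺ (λ l → listsOf l (map suc (upTo (sum c))))
                                (∈-upTo⁺ (s≤s (Parts12-length≤sum p)))))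
            (≡⇒≡ᵇ (sum c) (sum c) refl)

-- Segments between two parallel lines

≤ᵇ-true : ∀ {m n} → m ≤ n → (m ≤ᵇ n) ≡ true
≤ᵇ-true {m} {n} = dec-true (m ≤? n)

≤ᵇ-false : ∀ {m n} → n < m → (m ≤ᵇ n) ≡ false
≤ᵇ-false {m} {n} n<m = dec-false (m ≤? n) (<⇒≱ n<m)

between-inside : ∀ {a b e} → a ⊓ b ≤ e → e ≤ a ⊔ b → between a b e ≡ true
between-inside a⊓b≤e e≤a⊔b rewrite ≤ᵇ-true a⊓b≤e | ≤ᵇ-true e≤a⊔b = refl

between-beyond : ∀ {a b e} → a ⊔ b < e → between a b e ≡ false
between-beyond {a} {b} {e} a⊔b<e rewrite ≤ᵇ-false a⊔b<e = ∧-zeroʳ (a ⊓ b ≤ᵇ e)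

between-before : ∀ {a b e} → e < a ⊓ b → between a b e ≡ false
between-before e<a⊓b rewrite ≤ᵇ-false e<a⊓b = refl

parallel-order⇒false : ∀ {x y x′ y′} → x < x′ → y < y′ →
                       ((x ≤ᵇ x′) ∧ (y′ ≤ᵇ y)) ∨ ((x′ ≤ᵇ x) ∧ (y ≤ᵇ y′)) ≡ false
parallel-order⇒false {x} {y} {x′} {y′} x<x′ y<y′ =
  cong₂ _∨_ (trans (cong ((x ≤ᵇ x′) ∧_) (≤ᵇ-false y<y′)) (∧-zeroʳ (x ≤ᵇ x′)))
            (cong (_∧ (y ≤ᵇ y′)) (≤ᵇ-false x<x′))

module Geometry (k : ℕ) where

  onFirst-< : ∀ {p} → p < k → onFirst k p ≡ true
  onFirst-< {p} = dec-true (p <? k)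

  onFirst-≥ : ∀ {p} → k ≤ p → onFirst k p ≡ false
  onFirst-≥ {p} k≤p = dec-false (p <? k) (≤⇒≯ k≤p)

  lines-differ : ∀ {p q} → p < k → k ≤ q → onFirst k p ≢ onFirst k q
  lines-differ p<k k≤q p~q = case trans (sym (onFirst-< p<k)) (trans p~q (onFirst-≥ k≤q)) of λ ()

  sameLine⇒≡ : ∀ {a b} → sameLine k a b ≡ true → onFirst k a ≡ onFirst k b
  sameLine⇒≡ {a} {b} with onFirst k a | onFirst k b
  ... | true  | true  = λ _ → refl
  ... | false | false = λ _ → refl
  ... | true  | false = λ ()
  ... | false | true  = λ ()

  ≡⇒sameLine : ∀ {a b} → onFirst k a ≡ onFirst k b → sameLine k a b ≡ true
  ≡⇒sameLine {a} {b} with onFirst k a | onFirst k b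
  ... | true  | true  = λ _ → refl
  ... | false | false = λ _ → refl
  ... | true  | false = λ ()
  ... | false | true  = λ ()

  sameLine-false⇒≢ : ∀ {a b} → sameLine k a b ≡ false → onFirst k a ≢ onFirst k b
  sameLine-false⇒≢ ab a~b = case trans (sym ab) (≡⇒sameLine a~b) of λ ()

  sameLine-sym : ∀ a b → sameLine k a b ≡ sameLine k b a
  sameLine-sym a b with onFirst k a | onFirst k b
  ... | true  | true  = refl
  ... | false | false = refl
  ... | true  | false = refl
  ... | false | true  = refl

  endOnLineOf-line : ∀ a {c d} → sameLine k c d ≡ false → onFirst k a ≡ onFirst k (endOnLineOf k a c d)
  endOnLineOf-line a {c} {d} cd with sameLine k a c in ac
  ... | true  = sameLine⇒≡ ac
  ... | false = trans (¬-not (sameLine-false⇒≢ ac)) (sym (¬-not (sameLine-false⇒≢ cd ∘ sym)))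

  endOnLineOf-either : ∀ (P : ℕ → Set) a {c d} → P c → P d → P (endOnLineOf k a c d)
  endOnLineOf-either P a {c} Pc Pd with sameLine k a c
  ... | true  = Pc
  ... | false = Pd

  firstEnd-line : ∀ {a b} → onFirst k a ≢ onFirst k b → onFirst k (firstEnd k a b) ≡ true
  firstEnd-line {a} a≁b with onFirst k a in ea
  ... | true  = ea
  ... | false = ¬-not (a≁b ∘ sym)

  secondEnd-line : ∀ {a b} → onFirst k a ≢ onFirst k b → onFirst k (secondEnd k a b) ≡ false
  secondEnd-line {a} a≁b with onFirst k a in ea
  ... | false = ea
  ... | true  = ¬-not (a≁b ∘ sym)

  firstEnd-either : ∀ (P : ℕ → Set) {a b} → P a → P b → P (firstEnd k a b)
  firstEnd-either P {a} Pa Pb with onFirst k a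
  ... | true  = Pa
  ... | false = Pb

  secondEnd-either : ∀ (P : ℕ → Set) {a b} → P a → P b → P (secondEnd k a b)
  secondEnd-either P {a} Pa Pb with onFirst k a
  ... | true  = Pb
  ... | false = Pa

  meets-sym : ∀ s t → meets k s t ≡ meets k t s
  meets-sym (a , b) (c , d) with sameLine k a b | sameLine k c d
  ... | true  | true  = cong₂ _∧_ (sameLine-sym a c) (∧-comm (a ⊓ b ≤ᵇ c ⊔ d) (c ⊓ d ≤ᵇ a ⊔ b))
  ... | true  | false = refl
  ... | false | true  = refl
  ... | false | false =
    ∨-comm ((firstEnd k a b ≤ᵇ firstEnd k c d) ∧ (secondEnd k c d ≤ᵇ secondEnd k a b))
           ((firstEnd k c d ≤ᵇ firstEnd k a b) ∧ (secondEnd k a b ≤ᵇ secondEnd k c d))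

  _≺_ : ℕ → ℕ → Set
  x ≺ y = onFirst k x ≡ onFirst k y → x < y

  separated⇒¬meets : ∀ {a b c d} → a ≺ c → a ≺ d → b ≺ c → b ≺ d → meets k (a , b) (c , d) ≡ false
  separated⇒¬meets {a} {b} {c} {d} a≺c a≺d b≺c b≺d with sameLine k a b in ab | sameLine k c d in cd
  ... | true | true with sameLine k a c in ac
  ...   | false = refl
  ...   | true  = trans (cong ((a ⊓ b ≤ᵇ c ⊔ d) ∧_) (≤ᵇ-false a⊔b<c⊓d)) (∧-zeroʳ (a ⊓ b ≤ᵇ c ⊔ d))
    where
    a~c = sameLine⇒≡ ac
    a~d = trans a~c (sameLine⇒≡ cd)
    b~c = trans (sym (sameLine⇒≡ ab)) a~c
    b~d = trans b~c (sameLine⇒≡ cd)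
    a⊔b<c⊓d = ⊔-lub (⊓-glb (a≺c a~c) (a≺d a~d)) (⊓-glb (b≺c b~c) (b≺d b~d))
  separated⇒¬meets {a} {b} {c} {d} a≺c a≺d b≺c b≺d | true | false =
    between-beyond {a} {b} (⊔-lub (endOnLineOf-either (a ≺_) a a≺c a≺d a~e)
                                  (endOnLineOf-either (b ≺_) a b≺c b≺d b~e))
    where
    a~e = endOnLineOf-line a cd
    b~e = trans (sym (sameLine⇒≡ ab)) a~e
  separated⇒¬meets {a} {b} {c} {d} a≺c a≺d b≺c b≺d | false | true =
    between-before {c} {d} (⊓-glb (e≺c (sym c~e)) (e≺d (trans (sym c~e) (sameLine⇒≡ cd))))
    where
    c~e = endOnLineOf-line c ab
    e≺c = endOnLineOf-either (_≺ c) c a≺c b≺c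
    e≺d = endOnLineOf-either (_≺ d) c a≺d b≺d
  separated⇒¬meets {a} {b} {c} {d} a≺c a≺d b≺c b≺d | false | false = parallel-order⇒false x<x′ y<y′
    where
    a≁b = sameLine-false⇒≢ ab
    c≁d = sameLine-false⇒≢ cd
    x<x′ = firstEnd-either (_≺ firstEnd k c d)
                           (firstEnd-either (a ≺_) a≺c a≺d) (firstEnd-either (b ≺_) b≺c b≺d)
                           (trans (firstEnd-line a≁b) (sym (firstEnd-line c≁d)))
    y<y′ = secondEnd-either (_≺ secondEnd k c d)
                            (secondEnd-either (a ≺_) a≺c a≺d) (secondEnd-either (b ≺_) b≺c b≺d)
                            (trans (secondEnd-line a≁b) (sym (secondEnd-line c≁d)))

  meets-through-point : ∀ {a b e} z → onFirst k a ≡ onFirst k b → onFirst k a ≡ onFirst k e →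
                        a ⊓ b ≤ e → e ≤ a ⊔ b → meets k (a , b) (e , z) ≡ true
  meets-through-point {a} {b} {e} z a~b a~e lo hi with sameLine k a b | ≡⇒sameLine a~b | sameLine k e z
  ... | true | _ | true  rewrite ≡⇒sameLine a~e | ≤ᵇ-true (≤-trans lo (m≤m⊔n e z))
                               | ≤ᵇ-true (≤-trans (m⊓n≤m e z) hi) = refl
  ... | true | _ | false rewrite ≡⇒sameLine a~e = between-inside lo hi

  meets-crossing : ∀ {i x j y} → i < k → x < k → k ≤ j → k ≤ y → i ≤ x → j ≤ y →
                   meets k (i , y) (j , x) ≡ true
  meets-crossing {i} {x} {j} {y} i<k x<k k≤j k≤y i≤x j≤y with sameLine k i y in iy | sameLine k j x in jx
  ... | true  | _     = ⊥-elim (lines-differ i<k k≤y (sameLine⇒≡ iy))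
  ... | false | true  = ⊥-elim (lines-differ x<k k≤j (sym (sameLine⇒≡ jx)))
  ... | false | false rewrite onFirst-< i<k | onFirst-≥ k≤j | ≤ᵇ-true i≤x | ≤ᵇ-true j≤y = refl

-- Non-crossing matchings built from the left

link : ℕ → ℕ → (ℕ → ℕ) → ℕ → ℕ
link u w F p with p ≟ u | p ≟ w
... | yes _ | _     = w
... | no _  | yes _ = u
... | no _  | no _  = F p

link-left : ∀ u w F → link u w F u ≡ w
link-left u w F with u ≟ u
... | yes _  = refl
... | no u≢u = ⊥-elim (u≢u refl)

link-right : ∀ {u w} F → u ≢ w → link u w F w ≡ u
link-right {u} {w} F u≢w with w ≟ u | w ≟ w
... | yes w≡u | _      = ⊥-elim (u≢w (sym w≡u))
... | no _    | yes _  = refl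
... | no _    | no w≢w = ⊥-elim (w≢w refl)

link-other : ∀ {u w p} F → p ≢ u → p ≢ w → link u w F p ≡ F p
link-other {u} {w} {p} F p≢u p≢w with p ≟ u | p ≟ w
... | yes p≡u | _       = ⊥-elim (p≢u p≡u)
... | no _    | yes p≡w = ⊥-elim (p≢w p≡w)
... | no _    | no _    = refl

EqualOn : Pred ℕ 0ℓ → (ℕ → ℕ) → (ℕ → ℕ) → Set
EqualOn R F G = ∀ {p} → R p → F p ≡ G p

module Matchings (k : ℕ) where
  open Geometry k

  record NonCrossingMatching (R : Pred ℕ 0ℓ) (F : ℕ → ℕ) : Set where
    field
      closed       : ∀ {p} → R p → R (F p)
      fixpointFree : ∀ {p} → R p → F p ≢ p
      involutive   : ∀ {p} → R p → F (F p) ≡ p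
      nonCrossing  : ∀ {p q} → R p → R q → q ≢ p → q ≢ F p → meets k (p , F p) (q , F q) ≡ false

  open NonCrossingMatching

  matching-resp-≐ : ∀ {R S F} → R ≐ S → NonCrossingMatching R F → NonCrossingMatching S F
  matching-resp-≐ (R⊆S , S⊆R) M = record
    { closed       = λ p → R⊆S (closed M (S⊆R p))
    ; fixpointFree = λ p → fixpointFree M (S⊆R p)
    ; involutive   = λ p → involutive M (S⊆R p)
    ; nonCrossing  = λ p q → nonCrossing M (S⊆R p) (S⊆R q)
    }

  matching-resp-EqualOn : ∀ {R F G} → EqualOn R F G → NonCrossingMatching R F → NonCrossingMatching R G
  matching-resp-EqualOn {R} {F} {G} F≗G M = record
    { closed       = closedG
    ; fixpointFree = λ p → subst (_≢ _) (F≗G p) (fixpointFree M p)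
    ; involutive   = λ p → trans (sym (F≗G (closedG p))) (trans (cong F (sym (F≗G p))) (involutive M p))
    ; nonCrossing  = λ {p} {q} p∈ q∈ q≢p q≢Gp →
        subst₂ (λ x y → meets k (p , x) (q , y) ≡ false) (F≗G p∈) (F≗G q∈)
               (nonCrossing M p∈ q∈ q≢p (subst (q ≢_) (sym (F≗G p∈)) q≢Gp))
    }
    where
    closedG : ∀ {p} → R p → R (G p)
    closedG p = subst R (F≗G p) (closed M p)

  ≺⇒≢ : ∀ {u p} → u ≺ p → p ≢ u
  ≺⇒≢ u≺p refl = <-irrefl refl (u≺p refl)

  record LeftSplit (R : Pred ℕ 0ℓ) (u w : ℕ) (R′ : Pred ℕ 0ℓ) : Set where
    field
      distinct : u ≢ w
      split    : R ≐ ｛ u ｝ ∪ ｛ w ｝ ∪ R′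
      leftOf   : ∀ {p} → R′ p → u ≺ p × w ≺ p

    cases : ∀ {p} → R p → u ≡ p ⊎ w ≡ p ⊎ R′ p
    cases = proj₁ split

    left∈ : R u
    left∈ = proj₂ split (inj₁ refl)

    right∈ : R w
    right∈ = proj₂ split (inj₂ (inj₁ refl))

    rest⊆ : R′ ⊆ R
    rest⊆ p = proj₂ split (inj₂ (inj₂ p))

    rest≢left : ∀ {p} → R′ p → p ≢ u
    rest≢left p = ≺⇒≢ (proj₁ (leftOf p))

    rest≢right : ∀ {p} → R′ p → p ≢ w
    rest≢right p = ≺⇒≢ (proj₂ (leftOf p))

    link-rest : ∀ F {p} → R′ p → link u w F p ≡ F p
    link-rest F p = link-other F (rest≢left p) (rest≢right p)

  module _ {R u w R′} (S : LeftSplit R u w R′) where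
    open LeftSplit S

    link-matching : ∀ {F} → NonCrossingMatching R′ F → NonCrossingMatching R (link u w F)
    link-matching {F} M = record
      { closed = closed′ ; fixpointFree = fixpointFree′ ; involutive = involutive′ ; nonCrossing = nonCrossing′ }
      where
      L = link u w F

      closed′ : ∀ {p} → R p → R (L p)
      closed′ p with cases p
      ... | inj₁ refl        rewrite link-left u w F       = right∈
      ... | inj₂ (inj₁ refl) rewrite link-right F distinct = left∈
      ... | inj₂ (inj₂ p′)   rewrite link-rest F p′        = rest⊆ (closed M p′)

      fixpointFree′ : ∀ {p} → R p → L p ≢ p
      fixpointFree′ p with cases p
      ... | inj₁ refl        rewrite link-left u w F       = distinct ∘ sym
      ... | inj₂ (inj₁ refl) rewrite link-right F distinct = distinct
      ... | inj₂ (inj₂ p′)   rewrite link-rest F p′        = fixpointFree M p′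

      involutive′ : ∀ {p} → R p → L (L p) ≡ p
      involutive′ p with cases p
      ... | inj₁ refl        rewrite link-left u w F       = link-right F distinct
      ... | inj₂ (inj₁ refl) rewrite link-right F distinct = link-left u w F
      ... | inj₂ (inj₂ p′)   rewrite link-rest F p′        = trans (link-rest F (closed M p′)) (involutive M p′)

      clear : ∀ {q} → R′ q → meets k (u , w) (q , F q) ≡ false × meets k (w , u) (q , F q) ≡ false
      clear q′ with leftOf q′ | leftOf (closed M q′)
      ... | u≺q , w≺q | u≺Fq , w≺Fq =
        separated⇒¬meets u≺q u≺Fq w≺q w≺Fq , separated⇒¬meets w≺q w≺Fq u≺q u≺Fq

      nonCrossing′ : ∀ {p q} → R p → R q → q ≢ p → q ≢ L p → meets k (p , L p) (q , L q) ≡ false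
      nonCrossing′ {p} {q} p∈ q∈ q≢p q≢Lp with cases p∈ | cases q∈
      ... | inj₁ refl        | inj₁ refl        = ⊥-elim (q≢p refl)
      ... | inj₂ (inj₁ refl) | inj₂ (inj₁ refl) = ⊥-elim (q≢p refl)
      ... | inj₁ refl        | inj₂ (inj₁ refl) = ⊥-elim (q≢Lp (sym (link-left u w F)))
      ... | inj₂ (inj₁ refl) | inj₁ refl        = ⊥-elim (q≢Lp (sym (link-right F distinct)))
      ... | inj₁ refl        | inj₂ (inj₂ q′) rewrite link-left u w F | link-rest F q′ = proj₁ (clear q′)
      ... | inj₂ (inj₁ refl) | inj₂ (inj₂ q′) rewrite link-right F distinct | link-rest F q′ = proj₂ (clear q′)
      ... | inj₂ (inj₂ p′)   | inj₁ refl      rewrite link-left u w F | link-rest F p′ =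
        trans (meets-sym (p , F p) (u , w)) (proj₁ (clear p′))
      ... | inj₂ (inj₂ p′)   | inj₂ (inj₁ refl) rewrite link-right F distinct | link-rest F p′ =
        trans (meets-sym (p , F p) (w , u)) (proj₂ (clear p′))
      ... | inj₂ (inj₂ p′)   | inj₂ (inj₂ q′) rewrite link-rest F p′ | link-rest F q′ =
        nonCrossing M p′ q′ q≢p q≢Lp

    module _ {P} (M : NonCrossingMatching R P) (Pu≡w : P u ≡ w) where

      Pw≡u : P w ≡ u
      Pw≡u = trans (cong P (sym Pu≡w)) (involutive M left∈)

      restrict-matching : NonCrossingMatching R′ P
      restrict-matching = record
        { closed       = closed′
        ; fixpointFree = λ p′ → fixpointFree M (rest⊆ p′)
        ; involutive   = λ p′ → involutive M (rest⊆ p′)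
        ; nonCrossing  = λ p′ q′ → nonCrossing M (rest⊆ p′) (rest⊆ q′)
        }
        where
        back : ∀ {p} → R′ p → p ≡ P (P p)
        back p′ = sym (involutive M (rest⊆ p′))
        closed′ : ∀ {p} → R′ p → R′ (P p)
        closed′ {p} p′ with cases (closed M (rest⊆ p′))
        ... | inj₁ u≡Pp        = ⊥-elim (rest≢right p′ (trans (back p′) (trans (cong P (sym u≡Pp)) Pu≡w)))
        ... | inj₂ (inj₁ w≡Pp) = ⊥-elim (rest≢left p′ (trans (back p′) (trans (cong P (sym w≡Pp)) Pw≡u)))
        ... | inj₂ (inj₂ Pp′)  = Pp′

      link-agrees : ∀ {F} → EqualOn R′ F P → EqualOn R (link u w F) P
      link-agrees {F} F≗P p with cases p
      ... | inj₁ refl        = trans (link-left u w F) (sym Pu≡w)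
      ... | inj₂ (inj₁ refl) = trans (link-right F distinct) (sym Pw≡u)
      ... | inj₂ (inj₂ p′)   = trans (link-rest F p′) (F≗P p′)

    link-cancel : ∀ {F G} → EqualOn R (link u w F) (link u w G) → EqualOn R′ F G
    link-cancel {F} {G} L≗L p′ = trans (sym (link-rest F p′)) (trans (L≗L (rest⊆ p′)) (link-rest G p′))

  module _ {R P} (M : NonCrossingMatching R P) where

    no-nesting : ∀ {u} → R u → R (suc u) → onFirst k u ≡ onFirst k (P u) → onFirst k u ≡ onFirst k (suc u) →
                 suc u < P u → ⊥
    no-nesting {u} u∈ su∈ u~Pu u~su su<Pu =
      contradiction (trans (sym meet) (nonCrossing M u∈ su∈ (λ ()) (<⇒≢ su<Pu))) λ ()
      where
      meet = meets-through-point (P (suc u)) u~Pu u~su (≤-trans (m⊓n≤m u (P u)) (n≤1+n u))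
                                 (≤-trans (<⇒≤ su<Pu) (m≤n⊔m u (P u)))

    no-crossing⇒paired : ∀ {i j} → R i → R j → i < k → k ≤ j →
                         P j < k → k ≤ P i → i ≤ P j → j ≤ P i → P i ≡ j
    no-crossing⇒paired {i} {j} i∈ j∈ i<k k≤j Pj<k k≤Pi i≤Pj j≤Pi with P i ≟ j
    ... | yes Pi≡j = Pi≡j
    ... | no Pi≢j  = contradiction (trans (sym meet) (nonCrossing M i∈ j∈ j≢i (Pi≢j ∘ sym))) λ ()
      where
      meet = meets-crossing i<k Pj<k k≤j k≤Pi i≤Pj j≤Pi
      j≢i : j ≢ i
      j≢i j≡i = <⇒≱ i<k (subst (k ≤_) j≡i k≤j)

-- A part 2 joins two neighbours on its line; parts 1 heading both compositions join the two lines.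
-- First-line 2s are read first, which is also the order in which `decompose` recovers them.
decode : List ℕ → List ℕ → ℕ → ℕ → ℕ → ℕ
decode (2 ∷ c₁) c₂        i j = link i (suc i) (decode c₁ c₂ (2 + i) j)
decode (1 ∷ c₁) (2 ∷ c₂) i j = link j (suc j) (decode (1 ∷ c₁) c₂ i (2 + j))
decode []       (2 ∷ c₂) i j = link j (suc j) (decode [] c₂ i (2 + j))
decode (1 ∷ c₁) (1 ∷ c₂) i j = link i j (decode c₁ c₂ (suc i) (suc j))
decode _        _        _ _ = id

≤⇒≡∨< : ∀ {i p} → i ≤ p → i ≡ p ⊎ suc i ≤ p
≤⇒≡∨< i≤p with m≤n⇒m<n∨m≡n i≤p
... | inj₁ i<p = inj₂ i<p
... | inj₂ i≡p = inj₁ i≡p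

+-suc-suc : ∀ m n → m + suc (suc n) ≡ suc (suc (m + n))
+-suc-suc m n = trans (+-suc m (suc n)) (cong suc (+-suc m n))

shift₁ : ∀ {x i m} → suc (x + i) ≡ m → x + suc i ≡ m
shift₁ {x} {i} = trans (+-suc x i)

unshift₁ : ∀ {x i m} → x + suc i ≡ m → suc (x + i) ≡ m
unshift₁ {x} {i} = trans (sym (+-suc x i))

shift₂ : ∀ {x i m} → suc (suc (x + i)) ≡ m → x + suc (suc i) ≡ m
shift₂ {x} {i} = trans (+-suc-suc x i)

unshift₂ : ∀ {x i m} → x + suc (suc i) ≡ m → suc (suc (x + i)) ≡ m
unshift₂ {x} {i} = trans (sym (+-suc-suc x i))

span-bound₁ : ∀ x {i m} → suc (x + i) ≡ m → i < m
span-bound₁ x {i} e = subst (i <_) e (s≤s (m≤n+m i x))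

span-bound₂ : ∀ x {i m} → suc (suc (x + i)) ≡ m → suc i < m
span-bound₂ x {i} e = span-bound₁ x (trans (cong suc (+-suc x i)) e)

span-clash : ∀ x {i m} → suc (x + i) ≡ m → i ≢ m
span-clash x e = <⇒≢ (span-bound₁ x e)

module Regions (k N : ℕ) where
  open Geometry k
  open Matchings k

  Region : ℕ → ℕ → Pred ℕ 0ℓ
  Region i j p = (i ≤ p × p < k) ⊎ (j ≤ p × p < N)

  Region-mono : ∀ {i j i′ j′} → i ≤ i′ → j ≤ j′ → Region i′ j′ ⊆ Region i j
  Region-mono i≤i′ j≤j′ (inj₁ (i′≤p , p<k)) = inj₁ (≤-trans i≤i′ i′≤p , p<k)
  Region-mono i≤i′ j≤j′ (inj₂ (j′≤p , p<N)) = inj₂ (≤-trans j≤j′ j′≤p , p<N)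

  Region-empty : ∀ {p} → ¬ Region k N p
  Region-empty (inj₁ (k≤p , p<k)) = <⇒≱ p<k k≤p
  Region-empty (inj₂ (N≤p , p<N)) = <⇒≱ p<N N≤p

  empty-matching : ∀ F → NonCrossingMatching (Region k N) F
  empty-matching F = record
    { closed      = ⊥-elim ∘ Region-empty ; fixpointFree = ⊥-elim ∘ Region-empty
    ; involutive  = ⊥-elim ∘ Region-empty ; nonCrossing  = λ p → ⊥-elim (Region-empty p)
    }

  first-line-≺ : ∀ {u i′ j′ p} → u < k → u < i′ → k ≤ j′ → Region i′ j′ p → u ≺ p
  first-line-≺ u<k u<i′ k≤j′ (inj₁ (i′≤p , _)) _   = <-≤-trans u<i′ i′≤p
  first-line-≺ u<k u<i′ k≤j′ (inj₂ (j′≤p , _)) u~p = ⊥-elim (lines-differ u<k (≤-trans k≤j′ j′≤p) u~p)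

  second-line-≺ : ∀ {u i′ j′ p} → k ≤ u → u < j′ → Region i′ j′ p → u ≺ p
  second-line-≺ k≤u u<j′ (inj₁ (_ , p<k))  u~p = ⊥-elim (lines-differ p<k k≤u (sym u~p))
  second-line-≺ k≤u u<j′ (inj₂ (j′≤p , _)) _   = <-≤-trans u<j′ j′≤p

  Region-split-first : ∀ {i j} → suc i < k → k ≤ j → LeftSplit (Region i j) i (suc i) (Region (2 + i) j)
  Region-split-first {i} {j} si<k k≤j = record
    { distinct = <⇒≢ (n<1+n i)
    ; split    = cases , λ { (inj₁ refl)        → inj₁ (≤-refl , i<k)
                           ; (inj₂ (inj₁ refl)) → inj₁ (n≤1+n i , si<k)
                           ; (inj₂ (inj₂ p))    → Region-mono (m≤n+m i 2) ≤-refl p }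
    ; leftOf   = λ p → first-line-≺ i<k (m<n+m i (s≤s z≤n)) k≤j p , first-line-≺ si<k (n<1+n (suc i)) k≤j p
    }
    where
    i<k = <-trans (n<1+n i) si<k
    cases : ∀ {p} → Region i j p → i ≡ p ⊎ suc i ≡ p ⊎ Region (2 + i) j p
    cases (inj₂ p) = inj₂ (inj₂ (inj₂ p))
    cases (inj₁ (i≤p , p<k)) with ≤⇒≡∨< i≤p
    ... | inj₁ i≡p = inj₁ i≡p
    ... | inj₂ si≤p with ≤⇒≡∨< si≤p
    ...   | inj₁ si≡p  = inj₂ (inj₁ si≡p)
    ...   | inj₂ ssi≤p = inj₂ (inj₂ (inj₁ (ssi≤p , p<k)))

  Region-split-second : ∀ {i j} → k ≤ j → suc j < N → LeftSplit (Region i j) j (suc j) (Region i (2 + j))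
  Region-split-second {i} {j} k≤j sj<N = record
    { distinct = <⇒≢ (n<1+n j)
    ; split    = cases , λ { (inj₁ refl)        → inj₂ (≤-refl , <-trans (n<1+n j) sj<N)
                           ; (inj₂ (inj₁ refl)) → inj₂ (n≤1+n j , sj<N)
                           ; (inj₂ (inj₂ p))    → Region-mono ≤-refl (m≤n+m j 2) p }
    ; leftOf   = λ p → second-line-≺ k≤j (m<n+m j (s≤s z≤n)) p
                     , second-line-≺ (≤-trans k≤j (n≤1+n j)) (n<1+n (suc j)) p
    }
    where
    cases : ∀ {p} → Region i j p → j ≡ p ⊎ suc j ≡ p ⊎ Region i (2 + j) p
    cases (inj₁ p) = inj₂ (inj₂ (inj₁ p))
    cases (inj₂ (j≤p , p<N)) with ≤⇒≡∨< j≤p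
    ... | inj₁ j≡p = inj₁ j≡p
    ... | inj₂ sj≤p with ≤⇒≡∨< sj≤p
    ...   | inj₁ sj≡p  = inj₂ (inj₁ sj≡p)
    ...   | inj₂ ssj≤p = inj₂ (inj₂ (inj₂ (ssj≤p , p<N)))

  Region-split-crossing : ∀ {i j} → i < k → k ≤ j → j < N → LeftSplit (Region i j) i j (Region (suc i) (suc j))
  Region-split-crossing {i} {j} i<k k≤j j<N = record
    { distinct = λ i≡j → <⇒≱ i<k (subst (k ≤_) (sym i≡j) k≤j)
    ; split    = cases , λ { (inj₁ refl)        → inj₁ (≤-refl , i<k)
                           ; (inj₂ (inj₁ refl)) → inj₂ (≤-refl , j<N)
                           ; (inj₂ (inj₂ p))    → Region-mono (n≤1+n i) (n≤1+n j) p }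
    ; leftOf   = λ p → first-line-≺ i<k (n<1+n i) (≤-trans k≤j (n≤1+n j)) p , second-line-≺ k≤j (n<1+n j) p
    }
    where
    cases : ∀ {p} → Region i j p → i ≡ p ⊎ j ≡ p ⊎ Region (suc i) (suc j) p
    cases (inj₁ (i≤p , p<k)) with ≤⇒≡∨< i≤p
    ... | inj₁ i≡p  = inj₁ i≡p
    ... | inj₂ si≤p = inj₂ (inj₂ (inj₁ (si≤p , p<k)))
    cases (inj₂ (j≤p , p<N)) with ≤⇒≡∨< j≤p
    ... | inj₁ j≡p  = inj₂ (inj₁ j≡p)
    ... | inj₂ sj≤p = inj₂ (inj₂ (inj₂ (sj≤p , p<N)))

module Decoding (k N : ℕ) where
  open Geometry k
  open Matchings k
  open Regions k N

  record Fills (i j : ℕ) (c₁ c₂ : List ℕ) : Set where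
    constructor fills
    field
      parts₁ : Parts12 c₁
      parts₂ : Parts12 c₂
      ones   : numOnes c₁ ≡ numOnes c₂
      span₁  : sum c₁ + i ≡ k
      span₂  : sum c₂ + j ≡ N

  module _ {i j : ℕ} {c₁ c₂ : List ℕ} (k≤j : k ≤ j) where

    drop-first-two : Fills i j (2 ∷ c₁) c₂ → Fills (2 + i) j c₁ c₂
    drop-first-two (fills (two p₁) p₂ o s₁ s₂) = fills p₁ p₂ o (shift₂ s₁) s₂

    first-two-split : Fills i j (2 ∷ c₁) c₂ → LeftSplit (Region i j) i (suc i) (Region (2 + i) j)
    first-two-split F = Region-split-first (span-bound₂ (sum c₁) (Fills.span₁ F)) k≤j

    drop-second-two : Fills i j c₁ (2 ∷ c₂) → Fills i (2 + j) c₁ c₂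
    drop-second-two (fills p₁ (two p₂) o s₁ s₂) = fills p₁ p₂ o s₁ (shift₂ s₂)

    second-two-split : Fills i j c₁ (2 ∷ c₂) → LeftSplit (Region i j) j (suc j) (Region i (2 + j))
    second-two-split F = Region-split-second k≤j (span-bound₂ (sum c₂) (Fills.span₂ F))

    drop-one-one : Fills i j (1 ∷ c₁) (1 ∷ c₂) → Fills (suc i) (suc j) c₁ c₂
    drop-one-one (fills (one p₁) (one p₂) o s₁ s₂) = fills p₁ p₂ (suc-injective o) (shift₁ s₁) (shift₁ s₂)

    one-one-split : Fills i j (1 ∷ c₁) (1 ∷ c₂) → LeftSplit (Region i j) i j (Region (suc i) (suc j))
    one-one-split F =
      Region-split-crossing (span-bound₁ (sum c₁) (Fills.span₁ F)) k≤j (span-bound₁ (sum c₂) (Fills.span₂ F))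

  decode-matching : ∀ {i j c₁ c₂} → k ≤ j → Fills i j c₁ c₂ →
                    NonCrossingMatching (Region i j) (decode c₁ c₂ i j)
  decode-matching k≤j F@(fills (two _) _ _ _ _) =
    link-matching (first-two-split k≤j F) (decode-matching k≤j (drop-first-two k≤j F))
  decode-matching k≤j F@(fills (one _) (two _) _ _ _) =
    link-matching (second-two-split k≤j F) (decode-matching (≤-trans k≤j (m≤n+m _ 2)) (drop-second-two k≤j F))
  decode-matching k≤j F@(fills [] (two _) _ _ _) =
    link-matching (second-two-split k≤j F) (decode-matching (≤-trans k≤j (m≤n+m _ 2)) (drop-second-two k≤j F))
  decode-matching k≤j F@(fills (one _) (one _) _ _ _) =
    link-matching (one-one-split k≤j F) (decode-matching (≤-trans k≤j (n≤1+n _)) (drop-one-one k≤j F))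
  decode-matching _ (fills [] [] _ refl refl) = empty-matching id
  decode-matching _ (fills (one _) [] () _ _)
  decode-matching _ (fills [] (one _) () _ _)

  decode-one-crosses : ∀ {c₁ c₂ i j} → Parts12 c₂ → numOnes (1 ∷ c₁) ≡ numOnes c₂ → i < k → k ≤ j →
                       k ≤ decode (1 ∷ c₁) c₂ i j i
  decode-one-crosses {c₁} {2 ∷ c₂} {i} {j} (two p₂) o i<k k≤j
    rewrite link-other {j} {suc j} (decode (1 ∷ c₁) c₂ i (2 + j))
                       (<⇒≢ (<-≤-trans i<k k≤j)) (<⇒≢ (<-≤-trans i<k (≤-trans k≤j (n≤1+n j)))) =
      decode-one-crosses p₂ o i<k (≤-trans k≤j (m≤n+m j 2))
  decode-one-crosses {c₁} {1 ∷ c₂} {i} {j} (one p₂) o i<k k≤j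
    rewrite link-left i j (decode c₁ c₂ (suc i) (suc j)) = k≤j

  first-two-vs-one : ∀ {i j c₁ c₂ c₁′ c₂′} → k ≤ j →
                     Fills i j (2 ∷ c₁) c₂ → Fills i j (1 ∷ c₁′) c₂′ →
                     ¬ EqualOn (Region i j) (decode (2 ∷ c₁) c₂ i j) (decode (1 ∷ c₁′) c₂′ i j)
  first-two-vs-one {i} {j} {c₁} {c₂} k≤j F (fills _ p₂′ o′ _ _) D≗D′ =
    <⇒≱ si<k (subst (k ≤_) (sym si≡D′i) (decode-one-crosses p₂′ o′ (<-trans (n<1+n i) si<k) k≤j))
    where
    si<k = span-bound₂ (sum c₁) (Fills.span₁ F)
    si≡D′i = trans (sym (link-left i (suc i) (decode c₁ c₂ (2 + i) j)))
                   (D≗D′ (LeftSplit.left∈ (first-two-split k≤j F)))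

  second-two-vs-one : ∀ {i j c₁ c₂ c₁′ c₂′} → k ≤ j →
                      Fills i j (1 ∷ c₁) (2 ∷ c₂) → Fills i j (1 ∷ c₁′) (1 ∷ c₂′) →
                      ¬ EqualOn (Region i j) (decode (1 ∷ c₁) (2 ∷ c₂) i j)
                                             (decode (1 ∷ c₁′) (1 ∷ c₂′) i j)
  second-two-vs-one {i} {j} {c₁} {c₂} {c₁′} {c₂′} k≤j F F′ D≗D′ =
    <⇒≱ (span-bound₁ (sum c₁′) (Fills.span₁ F′)) (≤-trans k≤j (≤-trans (n≤1+n j) (≤-reflexive sj≡i)))
    where
    S′ = one-one-split k≤j F′
    sj≡i = trans (sym (link-left j (suc j) (decode (1 ∷ c₁) c₂ i (2 + j))))
                 (trans (D≗D′ (LeftSplit.right∈ S′))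
                        (link-right (decode c₁′ c₂′ (suc i) (suc j)) (LeftSplit.distinct S′)))

  decode-injective : ∀ {i j c₁ c₂ c₁′ c₂′} → k ≤ j → Fills i j c₁ c₂ → Fills i j c₁′ c₂′ →
                     EqualOn (Region i j) (decode c₁ c₂ i j) (decode c₁′ c₂′ i j) →
                     c₁ ≡ c₁′ × c₂ ≡ c₂′
  decode-injective k≤j F@(fills (two _) _ _ _ _) F′@(fills (two _) _ _ _ _) D≗D′
    with refl , refl ← decode-injective k≤j (drop-first-two k≤j F) (drop-first-two k≤j F′)
                                        (link-cancel (first-two-split k≤j F) D≗D′)
    = refl , refl
  decode-injective k≤j F@(fills (one _) (two _) _ _ _) F′@(fills (one _) (two _) _ _ _) D≗D′
    with refl , refl ← decode-injective (≤-trans k≤j (m≤n+m _ 2)) (drop-second-two k≤j F) (drop-second-two k≤j F′)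
                                        (link-cancel (second-two-split k≤j F) D≗D′)
    = refl , refl
  decode-injective k≤j F@(fills [] (two _) _ _ _) F′@(fills [] (two _) _ _ _) D≗D′
    with refl , refl ← decode-injective (≤-trans k≤j (m≤n+m _ 2)) (drop-second-two k≤j F) (drop-second-two k≤j F′)
                                        (link-cancel (second-two-split k≤j F) D≗D′)
    = refl , refl
  decode-injective k≤j F@(fills (one _) (one _) _ _ _) F′@(fills (one _) (one _) _ _ _) D≗D′
    with refl , refl ← decode-injective (≤-trans k≤j (n≤1+n _)) (drop-one-one k≤j F) (drop-one-one k≤j F′)
                                        (link-cancel (one-one-split k≤j F) D≗D′)
    = refl , refl
  decode-injective _ (fills [] [] _ _ _) (fills [] [] _ _ _) _ = refl , refl
  decode-injective k≤j F@(fills (two _) _ _ _ _) F′@(fills (one _) _ _ _ _) D≗D′ =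
    ⊥-elim (first-two-vs-one k≤j F F′ D≗D′)
  decode-injective k≤j F@(fills (one _) _ _ _ _) F′@(fills (two _) _ _ _ _) D≗D′ =
    ⊥-elim (first-two-vs-one k≤j F′ F (sym ∘ D≗D′))
  decode-injective k≤j F@(fills (one _) (two _) _ _ _) F′@(fills (one _) (one _) _ _ _) D≗D′ =
    ⊥-elim (second-two-vs-one k≤j F F′ D≗D′)
  decode-injective k≤j F@(fills (one _) (one _) _ _ _) F′@(fills (one _) (two _) _ _ _) D≗D′ =
    ⊥-elim (second-two-vs-one k≤j F′ F (sym ∘ D≗D′))
  decode-injective _ (fills (two {c} _) _ _ s _) (fills [] _ _ s′ _) _ = ⊥-elim (span-clash (suc (sum c)) s s′)
  decode-injective _ (fills [] _ _ s _) (fills (two {c} _) _ _ s′ _) _ = ⊥-elim (span-clash (suc (sum c)) s′ s)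
  decode-injective _ (fills (one {c} _) _ _ s _) (fills [] _ _ s′ _) _ = ⊥-elim (span-clash (sum c) s s′)
  decode-injective _ (fills [] _ _ s _) (fills (one {c} _) _ _ s′ _) _ = ⊥-elim (span-clash (sum c) s′ s)
  decode-injective _ (fills [] (two {c} _) _ _ s) (fills [] [] _ _ s′) _ = ⊥-elim (span-clash (suc (sum c)) s s′)
  decode-injective _ (fills [] [] _ _ s) (fills [] (two {c} _) _ _ s′) _ = ⊥-elim (span-clash (suc (sum c)) s′ s)
  decode-injective _ (fills (one _) [] () _ _) _ _
  decode-injective _ (fills [] (one _) () _ _) _ _
  decode-injective _ _ (fills (one _) [] () _ _) _
  decode-injective _ _ (fills [] (one _) () _ _) _

  record Decomposition (i j : ℕ) (P : ℕ → ℕ) : Set where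
    constructor decomposition
    field
      {c₁ c₂} : List ℕ
      good    : Fills i j c₁ c₂
      agrees  : EqualOn (Region i j) (decode c₁ c₂ i j) P

  module _ {P : ℕ → ℕ} where
    open NonCrossingMatching

    FirstTwo : ℕ → Set
    FirstTwo i = suc i < k × P i ≡ suc i

    SecondTwo : ℕ → Set
    SecondTwo j = suc j < N × P j ≡ suc j

    first-partner-crosses : ∀ {i j} → NonCrossingMatching (Region i j) P → i < k → ¬ FirstTwo i →
                            j ≤ P i × P i < N
    first-partner-crosses {i} M i<k ¬A with closed M (inj₁ (≤-refl , i<k))
    ... | inj₂ j≤Pi×Pi<N = j≤Pi×Pi<N
    ... | inj₁ (i≤Pi , Pi<k) with ≤⇒≡∨< i≤Pi
    ...   | inj₁ i≡Pi = ⊥-elim (fixpointFree M (inj₁ (≤-refl , i<k)) (sym i≡Pi))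
    ...   | inj₂ si≤Pi with ≤⇒≡∨< si≤Pi
    ...     | inj₁ si≡Pi = ⊥-elim (¬A (subst (_< k) (sym si≡Pi) Pi<k , sym si≡Pi))
    ...     | inj₂ si<Pi = ⊥-elim (no-nesting M (inj₁ (≤-refl , i<k)) (inj₁ (n≤1+n i , si<k))
                                              (trans (onFirst-< i<k) (sym (onFirst-< Pi<k)))
                                              (trans (onFirst-< i<k) (sym (onFirst-< si<k))) si<Pi)
      where si<k = <-trans si<Pi Pi<k

    second-partner-crosses : ∀ {i j} → NonCrossingMatching (Region i j) P → k ≤ j → j < N → ¬ SecondTwo j →
                             i ≤ P j × P j < k
    second-partner-crosses {i} {j} M k≤j j<N ¬B with closed M (inj₂ (≤-refl , j<N))
    ... | inj₁ i≤Pj×Pj<k = i≤Pj×Pj<k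
    ... | inj₂ (j≤Pj , Pj<N) with ≤⇒≡∨< j≤Pj
    ...   | inj₁ j≡Pj = ⊥-elim (fixpointFree M (inj₂ (≤-refl , j<N)) (sym j≡Pj))
    ...   | inj₂ sj≤Pj with ≤⇒≡∨< sj≤Pj
    ...     | inj₁ sj≡Pj = ⊥-elim (¬B (subst (_< N) (sym sj≡Pj) Pj<N , sym sj≡Pj))
    ...     | inj₂ sj<Pj = ⊥-elim (no-nesting M (inj₂ (≤-refl , j<N)) (inj₂ (n≤1+n j , <-trans sj<Pj Pj<N))
                                              (trans (onFirst-≥ k≤j) (sym (onFirst-≥ (≤-trans k≤j j≤Pj))))
                                              (trans (onFirst-≥ k≤j) (sym (onFirst-≥ (≤-trans k≤j (n≤1+n j)))))
                                              sj<Pj)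

    -- Each step joins a leftmost free point to its neighbour or, when neither is, the two leftmost points
    -- to each other.  FirstTwo and SecondTwo are decided before splitting on a and b so that every
    -- recursive call is on pattern variables, which the termination checker needs.
    decompose : ∀ a b {i j} → k ≤ j → a + i ≡ k → b + j ≡ N → NonCrossingMatching (Region i j) P →
                Decomposition i j P
    decompose-second : ∀ a b {i j} → k ≤ j → a + i ≡ k → b + j ≡ N → NonCrossingMatching (Region i j) P →
                       ¬ FirstTwo i → Decomposition i j P
    decompose-crossing : ∀ a b {i j} → k ≤ j → a + i ≡ k → b + j ≡ N → NonCrossingMatching (Region i j) P →
                         ¬ FirstTwo i → ¬ SecondTwo j → Decomposition i j P

    decompose a b {i} k≤j sa sb M with suc i <? k ×-dec P i ≟ suc i
    decompose (suc (suc a)) b {i} {j} k≤j sa sb M | yes (_ , Pi≡si) =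
      extend (decompose a b k≤j (shift₂ sa) sb (restrict-matching S M Pi≡si))
      where
      S = Region-split-first (span-bound₂ a sa) k≤j
      extend : Decomposition (2 + i) j P → Decomposition i j P
      extend (decomposition (fills p₁ p₂ o s₁ s₂) agrees) =
        decomposition (fills (two p₁) p₂ o (unshift₂ s₁) s₂) (link-agrees S M Pi≡si agrees)
    decompose 0 b {i} k≤j sa sb M | yes (si<k , _) = ⊥-elim (<-irrefl sa (<-trans (n<1+n i) si<k))
    decompose 1 b     k≤j sa sb M | yes (si<k , _) = ⊥-elim (<-irrefl sa si<k)
    decompose a b     k≤j sa sb M | no ¬A          = decompose-second a b k≤j sa sb M ¬A

    decompose-second a b {i} {j} k≤j sa sb M ¬A with suc j <? N ×-dec P j ≟ suc j
    decompose-second a (suc (suc b)) {i} {j} k≤j sa sb M ¬A | yes (_ , Pj≡sj) =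
      extend (decompose a b (≤-trans k≤j (m≤n+m j 2)) sa (shift₂ sb) (restrict-matching S M Pj≡sj))
      where
      S = Region-split-second k≤j (span-bound₂ b sb)
      extend : Decomposition i (2 + j) P → Decomposition i j P
      extend (decomposition (fills (two {c₁} p₁) p₂ o s₁ s₂) agrees) =
        ⊥-elim (¬A (si<k , trans (sym (agrees (inj₁ (≤-refl , <-trans (n<1+n i) si<k)))) (link-left i (suc i) _)))
        where si<k = span-bound₂ (sum c₁) s₁
      extend (decomposition (fills (one p₁) p₂ o s₁ s₂) agrees) =
        decomposition (fills (one p₁) (two p₂) o s₁ (unshift₂ s₂)) (link-agrees S M Pj≡sj agrees)
      extend (decomposition (fills [] p₂ o s₁ s₂) agrees) =
        decomposition (fills [] (two p₂) o s₁ (unshift₂ s₂)) (link-agrees S M Pj≡sj agrees)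
    decompose-second a 0 {j = j} k≤j sa sb M ¬A | yes (sj<N , _) = ⊥-elim (<-irrefl sb (<-trans (n<1+n j) sj<N))
    decompose-second a 1         k≤j sa sb M ¬A | yes (sj<N , _) = ⊥-elim (<-irrefl sb sj<N)
    decompose-second a b         k≤j sa sb M ¬A | no ¬B          = decompose-crossing a b k≤j sa sb M ¬A ¬B

    decompose-crossing 0 0 k≤j refl refl M _ _ = decomposition (fills [] [] refl refl refl) (⊥-elim ∘ Region-empty)
    decompose-crossing 0 (suc b) k≤j refl sb M _ ¬B =
      let i≤Pj , Pj<k = second-partner-crosses M k≤j (span-bound₁ b sb) ¬B in ⊥-elim (<⇒≱ Pj<k i≤Pj)
    decompose-crossing (suc a) 0 k≤j sa refl M ¬A _ =
      let j≤Pi , Pi<N = first-partner-crosses M (span-bound₁ a sa) ¬A in ⊥-elim (<⇒≱ Pi<N j≤Pi)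
    decompose-crossing (suc a) (suc b) {i} {j} k≤j sa sb M ¬A ¬B =
      extend (decompose a b (≤-trans k≤j (n≤1+n j)) (shift₁ sa) (shift₁ sb) (restrict-matching S M Pi≡j))
      where
      i<k = span-bound₁ a sa
      j<N = span-bound₁ b sb
      S = Region-split-crossing i<k k≤j j<N
      j≤Pi = proj₁ (first-partner-crosses M i<k ¬A)
      i≤Pj×Pj<k = second-partner-crosses M k≤j j<N ¬B
      Pi≡j = no-crossing⇒paired M (inj₁ (≤-refl , i<k)) (inj₂ (≤-refl , j<N)) i<k k≤j
                                (proj₂ i≤Pj×Pj<k) (≤-trans k≤j j≤Pi) (proj₁ i≤Pj×Pj<k) j≤Pi
      extend : Decomposition (suc i) (suc j) P → Decomposition i j P
      extend (decomposition (fills p₁ p₂ o s₁ s₂) agrees) =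
        decomposition (fills (one p₁) (one p₂) (cong suc o) (unshift₁ s₁) (unshift₁ s₂))
                      (link-agrees S M Pi≡j agrees)

-- Pairings as vectors, and the bijection

all-allFin⁺ : ∀ {m} (p : Fin m → Bool) → T (all p (allFin m)) → ∀ i → T (p i)
all-allFin⁺ p t i = All.lookup (All.all⁺ p _ t) (∈-allFin i)

all-allFin⁻ : ∀ {m} (p : Fin m → Bool) → (∀ i → T (p i)) → T (all p (allFin m))
all-allFin⁻ {m} p h = All.all⁻ p {xs = allFin m} (All.tabulate λ {i} _ → h i)

≡ᵇ-true : ∀ {x y} → x ≡ y → (x ≡ᵇ y) ≡ true
≡ᵇ-true {x} {y} = dec-true (x ≟ y)

≡ᵇ-false : ∀ {x y} → x ≢ y → (x ≡ᵇ y) ≡ false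
≡ᵇ-false {x} {y} = dec-false (x ≟ y)

T-not-≡ᵇ⇒≢ : ∀ {x y} → T (not (x ≡ᵇ y)) → x ≢ y
T-not-≡ᵇ⇒≢ {x} t refl = subst T (Equivalence.to T-not-≡ t) (≡⇒≡ᵇ x x refl)

module PartnerMaps (N : ℕ) where

  partnerOf : Vec (Fin N) N → ℕ → ℕ
  partnerOf v p with p <? N
  ... | yes p<N = partner v (fromℕ< p<N)
  ... | no _    = p

  partnerOf-toℕ : ∀ v f → partnerOf v (toℕ f) ≡ partner v f
  partnerOf-toℕ v f with toℕ f <? N
  ... | yes f<N = cong (partner v) (fromℕ<-toℕ f f<N)
  ... | no f≮N  = ⊥-elim (f≮N (toℕ<n f))

  ∀Fin⇒∀< : ∀ {Q : ℕ → Set} → (∀ f → Q (toℕ f)) → ∀ {p} → p < N → Q p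
  ∀Fin⇒∀< {Q} h p<N = subst Q (toℕ-fromℕ< p<N) (h (fromℕ< p<N))

  clamp : ℕ → Fin N → Fin N
  clamp x d with x <? N
  ... | yes x<N = fromℕ< x<N
  ... | no _    = d

  toℕ-clamp : ∀ {x} d → x < N → toℕ (clamp x d) ≡ x
  toℕ-clamp {x} d x<N with x <? N
  ... | yes _  = toℕ-fromℕ< _
  ... | no x≮N = ⊥-elim (x≮N x<N)

  toVec : (ℕ → ℕ) → Vec (Fin N) N
  toVec F = tabulate λ f → clamp (F (toℕ f)) f

  partnerOf-toVec : ∀ {F} → (∀ {p} → p < N → F p < N) → EqualOn (_< N) (partnerOf (toVec F)) F
  partnerOf-toVec {F} F<N = ∀Fin⇒∀< λ f → begin
    partnerOf (toVec F) (toℕ f) ≡⟨ partnerOf-toℕ (toVec F) f ⟩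
    toℕ (lookup (toVec F) f)    ≡⟨ cong toℕ (lookup∘tabulate _ f) ⟩
    toℕ (clamp (F (toℕ f)) f)   ≡⟨ toℕ-clamp f (F<N (toℕ<n f)) ⟩
    F (toℕ f)                   ∎
    where open ≡-Reasoning

  toVec-partnerOf : ∀ {F v} → EqualOn (_< N) F (partnerOf v) → toVec F ≡ v
  toVec-partnerOf {F} {v} F≗P = trans (tabulate-cong entry) (tabulate∘lookup v)
    where
    F≡partner : ∀ f → F (toℕ f) ≡ toℕ (lookup v f)
    F≡partner f = trans (F≗P (toℕ<n f)) (partnerOf-toℕ v f)
    entry : ∀ f → clamp (F (toℕ f)) f ≡ lookup v f
    entry f = toℕ-injective (trans (toℕ-clamp f (subst (_< N) (sym (F≡partner f)) (toℕ<n (lookup v f))))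
                                   (F≡partner f))

module ValidMatchings (k n : ℕ) where
  N = k + n
  open PartnerMaps N
  open Matchings k
  open NonCrossingMatching

  module _ (v : Vec (Fin N) N) where
    private
      P = partnerOf v
      P-toℕ = partnerOf-toℕ v

    NoCrossingAt : ℕ → Set
    NoCrossingAt p = ∀ {q} → q < N → q ≢ p → q ≢ P p → meets k (p , P p) (q , P q) ≡ false

    valid⇒matching : T (validMatching k n v) → NonCrossingMatching (_< N) P
    valid⇒matching t = record
      { closed       = ∀Fin⇒∀< λ f → subst (_< N) (sym (P-toℕ f)) (toℕ<n (lookup v f))
      ; fixpointFree = ∀Fin⇒∀< λ f → subst (_≢ toℕ f) (sym (P-toℕ f)) (T-not-≡ᵇ⇒≢ (proj₁ (pairing f)))
      ; involutive   = ∀Fin⇒∀< λ f →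
                         trans (cong P (P-toℕ f)) (trans (P-toℕ (lookup v f)) (≡ᵇ⇒≡ _ _ (proj₂ (pairing f))))
      ; nonCrossing  = λ p<N → ∀Fin⇒∀< {Q = NoCrossingAt} (λ f → ∀Fin⇒∀< (separated f)) p<N
      }
      where
      pairing : ∀ f → T (not (partner v f ≡ᵇ toℕ f)) × T (toℕ (lookup v (lookup v f)) ≡ᵇ toℕ f)
      pairing f = Equivalence.to T-∧ (all-allFin⁺ _ (proj₁ (Equivalence.to T-∧ t)) f)
      separated : ∀ f g → toℕ g ≢ toℕ f → toℕ g ≢ P (toℕ f) →
                  meets k (toℕ f , P (toℕ f)) (toℕ g , P (toℕ g)) ≡ false
      separated f g g≢f g≢Pf rewrite P-toℕ f | P-toℕ g
        with Equivalence.to T-∨ (all-allFin⁺ _ (all-allFin⁺ _ (proj₂ (Equivalence.to T-∧ t)) f) g)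
      ... | inj₁ f≡g = ⊥-elim (g≢f (sym (≡ᵇ⇒≡ _ _ f≡g)))
      ... | inj₂ rest with Equivalence.to T-∨ rest
      ...   | inj₁ g≡Pf  = ⊥-elim (g≢Pf (≡ᵇ⇒≡ _ _ g≡Pf))
      ...   | inj₂ ¬meet = Equivalence.to T-not-≡ ¬meet

    matching⇒valid : NonCrossingMatching (_< N) P → T (validMatching k n v)
    matching⇒valid M =
      Equivalence.from T-∧ (all-allFin⁻ _ pairing , all-allFin⁻ _ λ f → all-allFin⁻ _ (separated f))
      where
      pairing : ∀ f → T (not (partner v f ≡ᵇ toℕ f) ∧ (toℕ (lookup v (lookup v f)) ≡ᵇ toℕ f))
      pairing f rewrite ≡ᵇ-false (subst (_≢ toℕ f) (P-toℕ f) (fixpointFree M (toℕ<n f)))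
                      | ≡ᵇ-true (trans (sym (trans (cong P (P-toℕ f)) (P-toℕ (lookup v f)))) (involutive M (toℕ<n f)))
                      = _
      apart : ∀ f g → toℕ g ≢ toℕ f → toℕ g ≢ partner v f →
              meets k (toℕ f , partner v f) (toℕ g , partner v g) ≡ false
      apart f g g≢f g≢Pf = subst₂ (λ x y → meets k (toℕ f , x) (toℕ g , y) ≡ false) (P-toℕ f) (P-toℕ g)
                                  (nonCrossing M (toℕ<n f) (toℕ<n g) g≢f (subst (toℕ g ≢_) (sym (P-toℕ f)) g≢Pf))
      separated : ∀ f g → T ((toℕ f ≡ᵇ toℕ g) ∨ (toℕ g ≡ᵇ partner v f)
                              ∨ not (meets k (toℕ f , partner v f) (toℕ g , partner v g)))
      separated f g with toℕ f ≟ toℕ g | toℕ g ≟ partner v f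
      ... | yes f≡g | _        rewrite ≡ᵇ-true f≡g = _
      ... | no f≢g  | yes g≡Pf rewrite ≡ᵇ-false f≢g | ≡ᵇ-true g≡Pf = _
      ... | no f≢g  | no g≢Pf  rewrite ≡ᵇ-false f≢g | ≡ᵇ-false g≢Pf | apart f g (f≢g ∘ sym) g≢Pf = _

module Bijection (k n : ℕ) where
  open PartnerMaps (k + n)
  open ValidMatchings k n
  open Matchings k
  open Regions k N
  open Decoding k N
  open NonCrossingMatching

  GoodPairs : List (List ℕ × List ℕ)
  GoodPairs = filterᵇ goodPair (cartesianProduct (compositions k) (compositions n))

  NonCrossingPairings : List (Vec (Fin N) N)
  NonCrossingPairings = filterᵇ (validMatching k n) (allVecs N N)

  ∈-GoodPairs⁻ : ∀ {c₁ c₂} → (c₁ , c₂) ∈ GoodPairs → Fills 0 k c₁ c₂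
  ∈-GoodPairs⁻ {c₁} {c₂} c∈
    with ∈-filter⁻ (T? ∘ goodPair) {xs = cartesianProduct (compositions k) (compositions n)} c∈
  ... | c∈× , good with ∈-cartesianProduct⁻ (compositions k) (compositions n) c∈× | Equivalence.to T-∧ good
  ...   | c₁∈ , c₂∈ | parts₁ , rest with Equivalence.to T-∧ rest
  ...     | parts₂ , ones =
    fills (partsIn12⇒Parts12 c₁ parts₁) (partsIn12⇒Parts12 c₂ parts₂) (≡ᵇ⇒≡ _ _ ones)
          (trans (+-identityʳ (sum c₁)) (sum-composition c₁∈))
          (trans (+-comm (sum c₂) k) (cong (k +_) (sum-composition c₂∈)))

  ∈-GoodPairs⁺ : ∀ {c₁ c₂} → Fills 0 k c₁ c₂ → (c₁ , c₂) ∈ GoodPairs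
  ∈-GoodPairs⁺ {c₁} {c₂} (fills p₁ p₂ o s₁ s₂) =
    ∈-filter⁺ (T? ∘ goodPair) (∈-cartesianProduct⁺ c₁∈ c₂∈)
              (Equivalence.from T-∧ (Parts12⇒partsIn12 p₁ ,
                                     Equivalence.from T-∧ (Parts12⇒partsIn12 p₂ , ≡⇒≡ᵇ _ _ o)))
    where
    c₁∈ = subst (λ m → c₁ ∈ compositions m) (trans (sym (+-identityʳ (sum c₁))) s₁)
                (Parts12-∈-compositions p₁)
    c₂∈ = subst (λ m → c₂ ∈ compositions m) (+-cancelˡ-≡ k _ _ (trans (+-comm k (sum c₂)) s₂))
                (Parts12-∈-compositions p₂)

  Region≐bounded : Region 0 k ≐ (_< N)
  Region≐bounded = to , from
    where
    to : Region 0 k ⊆ (_< N)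
    to (inj₁ (_ , p<k)) = <-≤-trans p<k (m≤m+n k n)
    to (inj₂ (_ , p<N)) = p<N
    from : (_< N) ⊆ Region 0 k
    from {p} p<N with p <? k
    ... | yes p<k = inj₁ (z≤n , p<k)
    ... | no p≮k  = inj₂ (≮⇒≥ p≮k , p<N)

  encode : List ℕ × List ℕ → Vec (Fin N) N
  encode (c₁ , c₂) = toVec (decode c₁ c₂ 0 k)

  module _ {c₁ c₂} (F : Fills 0 k c₁ c₂) where

    decode-matching-bounded : NonCrossingMatching (_< N) (decode c₁ c₂ 0 k)
    decode-matching-bounded = matching-resp-≐ Region≐bounded (decode-matching ≤-refl F)

    partnerOf-encode : EqualOn (_< N) (partnerOf (encode (c₁ , c₂))) (decode c₁ c₂ 0 k)
    partnerOf-encode = partnerOf-toVec (closed decode-matching-bounded)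

    encode-valid : T (validMatching k n (encode (c₁ , c₂)))
    encode-valid = matching⇒valid _ (matching-resp-EqualOn (sym ∘ partnerOf-encode) decode-matching-bounded)

  encode-injective : ∀ {c₁ c₂ c₁′ c₂′} → Fills 0 k c₁ c₂ → Fills 0 k c₁′ c₂′ →
                     encode (c₁ , c₂) ≡ encode (c₁′ , c₂′) → (c₁ , c₂) ≡ (c₁′ , c₂′)
  encode-injective {c₁} {c₂} {c₁′} {c₂′} F F′ e =
    ×-≡,≡→≡ (decode-injective ≤-refl F F′ (agree ∘ proj₁ Region≐bounded))
    where
    agree : EqualOn (_< N) (decode c₁ c₂ 0 k) (decode c₁′ c₂′ 0 k)
    agree {p} p<N = trans (sym (partnerOf-encode F p<N)) (trans (cong (λ v → partnerOf v p) e) (partnerOf-encode F′ p<N))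

  encode-surjective : ∀ {v} → T (validMatching k n v) → ∃ λ c → Fills 0 k (proj₁ c) (proj₂ c) × encode c ≡ v
  encode-surjective {v} t
    with decomposition F agrees ← decompose k n ≤-refl (+-identityʳ k) (+-comm n k)
                                            (matching-resp-≐ (swap Region≐bounded) (valid⇒matching v t))
    = _ , F , toVec-partnerOf (agrees ∘ proj₂ Region≐bounded)

  GoodPairs-unique : Unique GoodPairs
  GoodPairs-unique =
    Unique.filter⁺ (T? ∘ goodPair) (Unique.cartesianProduct⁺ (compositions-unique k) (compositions-unique n))

  NonCrossingPairings-unique : Unique NonCrossingPairings
  NonCrossingPairings-unique = Unique.filter⁺ (T? ∘ validMatching k n) (allVecs-unique N N)

  encode-∈ : ∀ {c} → c ∈ GoodPairs → encode c ∈ NonCrossingPairings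
  encode-∈ {_ , _} c∈ = ∈-filter⁺ (T? ∘ validMatching k n) (∈-allVecs _) (encode-valid (∈-GoodPairs⁻ c∈))

  encode-injectiveOn : ∀ {c c′} → c ∈ GoodPairs → c′ ∈ GoodPairs → encode c ≡ encode c′ → c ≡ c′
  encode-injectiveOn {_ , _} {_ , _} c∈ c′∈ = encode-injective (∈-GoodPairs⁻ c∈) (∈-GoodPairs⁻ c′∈)

  encode-onto : ∀ {v} → v ∈ NonCrossingPairings → ∃ λ c → c ∈ GoodPairs × encode c ≡ v
  encode-onto v∈
    with c , F , e ← encode-surjective (proj₂ (∈-filter⁻ (T? ∘ validMatching k n) {xs = allVecs N N} v∈))
    = c , ∈-GoodPairs⁺ F , e

mainTheorem3 : (k n : ℕ) → a k n ≡ compositionPairCount k n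
mainTheorem3 k n =
  sym (length-≡-by-bijection encode GoodPairs-unique NonCrossingPairings-unique encode-∈ encode-injectiveOn encode-onto)
  where open Bijection k n
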